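{- Let $G$ and $H$ be graphs on the same vertex set $V$ with $|V|\geq 6$, both $2$-connected and outerplanar. If $G$ and $H$ have the same set of connected triples, then $G=H$.
   Context: All graphs are finite and simple. A connected triple of a graph $G$ is a $3$-element subset $\{a,b,c\}\subseteq V(G)$ such that $G[\{a,b,c\}]$ is connected. A graph is $k$-connected if it has more than $k$ vertices and cannot be disconnected by removing fewer than $k$ vertices. Graphs are labelled: equality means equal edge sets. -}

module Defs where

open import Data.Nat using (ℕ; _<_; _≤_)
open import Data.Bool using (Bool; true; false)
open import Data.Fin using (Fin) renaming (_<_ to _<ᶠ_)
open import Data.Fin.Subset using (Subset; _∉_; ∣_∣)
open import Data.Product using (Σ; _×_; ∃)
open import Relation.Binary.PropositionalEquality using (_≡_; _≢_)
open import Relation.Nullary using (¬_)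
open import Function.Definitions using (Injective)
open import Function.Bundles using (_⇔_)

record Graph (n : ℕ) : Set where
  field
    adj   : Fin n → Fin n → Bool
    sym   : ∀ u v → adj u v ≡ adj v u
    irrefl : ∀ u → adj u u ≡ false
open Graph public

Edge : ∀ {n} → Graph n → Fin n → Fin n → Set
Edge G u v = adj G u v ≡ true

SameGraph : ∀ {n} → Graph n → Graph n → Set
SameGraph G H = ∀ u v → adj G u v ≡ adj H u v

data WalkIn {n} (G : Graph n) (S : Fin n → Set) : Fin n → Fin n → Set where
  here : ∀ {x} → S x → WalkIn G S x x
  step : ∀ {x z y} → S x → Edge G x z → WalkIn G S z y → WalkIn G S x y

ConnectedOn : ∀ {n} → Graph n → (Fin n → Set) → Set
ConnectedOn G S = ∀ x y → S x → S y → WalkIn G S x y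

KConnected : ℕ → ∀ {n} → Graph n → Set
KConnected k {n} G =
  (k < n) × (∀ (X : Subset n) → ∣ X ∣ < k → ConnectedOn G (λ v → v ∉ X))

ConnectedTriple : ∀ {n} → Graph n → Fin n → Fin n → Fin n → Set
ConnectedTriple G a b c =
  (a ≢ b) × (b ≢ c) × (a ≢ c) ×
  ConnectedOn G (λ v → (v ≡ a) Data.Sum.⊎ ((v ≡ b) Data.Sum.⊎ (v ≡ c)))
  where import Data.Sum

-- Outerplanar: the vertices can be placed in a cyclic order on a circle
-- (positions given by an injective pos : Fin n → Fin n) such that no two
-- edges, drawn as chords, cross; i.e. there are no edges ab, cd with
-- pos a < pos c < pos b < pos d.
Outerplanar : ∀ {n} → Graph n → Set
Outerplanar {n} G =
  ∃ λ (pos : Fin n → Fin n) →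
    Injective _≡_ _≡_ pos ×
    (∀ a b c d → Edge G a b → Edge G c d →
       ¬ ((pos a <ᶠ pos c) × (pos c <ᶠ pos b) × (pos b <ᶠ pos d)))

SameConnectedTriples : ∀ {n} → Graph n → Graph n → Set
SameConnectedTriples G H =
  ∀ a b c → ConnectedTriple G a b c ⇔ ConnectedTriple H a b c

{-# OPTIONS --safe #-}
-- A triple is connected exactly when at least two of its three pairs are edges, so the
-- hypothesis says that on every triple the majority of the three adjacency bits is the same
-- in G and in H.  Suppose ab is an edge of G but not of H.  Comparing the triples {a, b, w}
-- shows that every other G-neighbour of a or b is a common H-neighbour of a and b; as the
-- outerplanar H contains no K₂,₃ there are at most two such vertices, and as G is 2-connected
-- there are at least two, c and d.  The remaining vertices (at least two, since n ≥ 6) are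
-- G-adjacent to neither a nor b.  If c and d are both G-adjacent to a and b, they lie on
-- opposite sides of the chord ab of G, and the remaining vertices on either side can leave it
-- only through whichever of c, d lies on that side.  Otherwise, say d is G-adjacent to a but
-- not to b; comparing triples shows that d has at most one G-neighbour e among the remaining
-- vertices and that e has none, so the remaining vertices not adjacent to d can leave only
-- through c.  Either way G would have a cut vertex.
module Submission where

open import Defs hiding (sym)
open import Data.Nat using (ℕ; _≤_; z≤n; s≤s)
import Data.Nat as ℕ
import Data.Nat.Properties as ℕ
open import Data.Bool using (Bool; true; false; _∧_; _∨_)
import Data.Bool.Properties as Bool
open import Data.Bool.Properties using (∨-zeroʳ; ∨-identityʳ; ∧-conicalˡ; ∧-conicalʳ; ⇔→≡; ¬-not; not-¬)
open import Data.Fin using (Fin; _<_; _<?_)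
open import Data.Fin.Properties using (_≟_; <-cmp; <-asym; <-irrefl; ¬∀⟶∃¬; pigeonhole)
open import Data.Fin.Subset using (⁅_⁆; _∉_)
open import Data.Fin.Subset.Properties using (x∉⁅y⁆⇒x≢y; x≢y⇒x∉⁅y⁆; ∣⁅x⁆∣≡1)
open import Data.List using (List; []; _∷_; length; lookup)
open import Data.List.Membership.Propositional using (_∈_)
open import Data.List.Relation.Unary.All using (All; []; _∷_; all?)
open import Data.List.Relation.Unary.All.Properties using (¬Any⇒All¬)
open import Data.List.Relation.Unary.Any using (index; any?)
open import Data.List.Relation.Unary.Any.Properties using (lookup-index)
open import Data.Product using (_×_; _,_; proj₁; proj₂; ∃; ∃₂; map₂; swap)
open import Data.Sum using (_⊎_; inj₁; inj₂; [_,_]) renaming (swap to ⊎-swap)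
open import Data.Empty using (⊥)
open import Function using (_∘_)
open import Function.Bundles using (mk⇔; Equivalence)
open import Level using (0ℓ)
open import Relation.Binary using (tri<; tri≈; tri>)
open import Relation.Binary.PropositionalEquality
  using (_≡_; _≢_; refl; sym; trans; cong; cong₂; subst; ≢-sym; module ≡-Reasoning)
open import Relation.Nullary using (¬_; Dec; yes; no; contradiction)
open import Relation.Nullary.Decidable using (_×-dec_; _⊎-dec_; ¬?; decidable-stable)
open import Relation.Unary using (Pred; Decidable)

majority : Bool → Bool → Bool → Bool
majority true  q r = q ∨ r
majority false q r = q ∧ r

∨-true : ∀ {p q} → p ≡ true ⊎ q ≡ true → p ∨ q ≡ true
∨-true     (inj₁ refl) = refl
∨-true {p} (inj₂ refl) = ∨-zeroʳ p

majority-intro : ∀ {p q r} → p ≡ true ⊎ q ≡ true → p ≡ true ⊎ r ≡ true → q ≡ true ⊎ r ≡ true →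
                 majority p q r ≡ true
majority-intro {true}  _        _        q∨r = ∨-true q∨r
majority-intro {false} (inj₂ q) (inj₂ r) _   = cong₂ _∧_ q r
majority-intro {false} (inj₁ ()) _       _
majority-intro {false} _        (inj₁ ()) _

majority-elim : ∀ {p q r} → majority p q r ≡ true →
                (p ≡ true × q ≡ true) ⊎ (p ≡ true × r ≡ true) ⊎ (q ≡ true × r ≡ true)
majority-elim {true}  {true}      _  = inj₁ (refl , refl)
majority-elim {true}  {false}     r  = inj₂ (inj₁ (refl , r))
majority-elim {false} {q}     {r} qr = inj₂ (inj₂ (∧-conicalˡ q r qr , ∧-conicalʳ q r qr))

fresh : ∀ {n} (xs : List (Fin n)) → length xs ℕ.< n → ∃ λ y → All (y ≢_) xs
fresh {n} xs |xs|<n = map₂ (¬Any⇒All¬ xs) (¬∀⟶∃¬ n (_∈ xs) (λ y → any? (y ≟_) xs) all-listed)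
  where
  all-listed : ¬ (∀ y → y ∈ xs)
  all-listed listed with i , j , i<j , same-index ← pigeonhole |xs|<n (index ∘ listed) =
    <-irrefl i≡j i<j
    where
    i≡j : i ≡ j
    i≡j = trans (lookup-index (listed i))
                (trans (cong (lookup xs) same-index) (sym (lookup-index (listed j))))

connectedTripleᵇ : ∀ {n} → Graph n → Fin n → Fin n → Fin n → Bool
connectedTripleᵇ G x y z = majority (adj G x y) (adj G x z) (adj G y z)

module _ {n} (G : Graph n) where

  edge-sym : ∀ {u v} → Edge G u v → Edge G v u
  edge-sym {u} {v} e = trans (Graph.sym G v u) e

  edge⇒≢ : ∀ {u v} → Edge G u v → u ≢ v
  edge⇒≢ {u} e refl = not-¬ e (Graph.irrefl G u)

  edge? : ∀ u v → Dec (Edge G u v)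
  edge? u v = adj G u v Bool.≟ true

  walk-start : ∀ {S x y} → WalkIn G S x y → S x
  walk-start (here Sx)     = Sx
  walk-start (step Sx _ _) = Sx

  walk-exits : ∀ {S x y} {P : Pred (Fin n) 0ℓ} → Decidable P → WalkIn G S x y → P x → ¬ P y →
               ∃₂ λ u w → P u × ¬ P w × S w × Edge G u w
  walk-exits P? (here _)              Px ¬Py = contradiction Px ¬Py
  walk-exits P? (step {z = z} _ e zy) Px ¬Py with P? z
  ... | yes Pz = walk-exits P? zy Pz ¬Py
  ... | no ¬Pz = _ , _ , Px , ¬Pz , walk-start zy , e

  exit-avoiding : KConnected 2 G → ∀ {P : Pred (Fin n) 0ℓ} → Decidable P → ∀ {x y z} →
                  P x → ¬ P y → x ≢ z → y ≢ z → ∃₂ λ u w → P u × ¬ P w × w ≢ z × Edge G u w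
  exit-avoiding (_ , connected) P? {x} {y} {z} Px ¬Py x≢z y≢z =
    let u , w , Pu , ¬Pw , w∉⁅z⁆ , uw = walk-exits P? avoiding-z Px ¬Py
    in  u , w , Pu , ¬Pw , x∉⁅y⁆⇒x≢y w∉⁅z⁆ , uw
    where
    avoiding-z : WalkIn G (_∉ ⁅ z ⁆) x y
    avoiding-z = connected ⁅ z ⁆ (subst (ℕ._< 2) (sym (∣⁅x⁆∣≡1 z)) ℕ.≤-refl) x y
                           (x≢y⇒x∉⁅y⁆ x≢z) (x≢y⇒x∉⁅y⁆ y≢z)

  first-step : ∀ {S x y} → ConnectedOn G S → S x → S y → x ≢ y → ∃ λ w → S w × Edge G x w
  first-step connected Sx Sy x≢y with connected _ _ Sx Sy
  ... | here _      = contradiction refl x≢y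
  ... | step _ e wy = _ , walk-start wy , e

  star : ∀ {S m} → S m → (∀ {s} → S s → s ≡ m ⊎ Edge G m s) → ConnectedOn G S
  star {S} {m} Sm spoke u v Su Sv = via-centre (spoke Su) (spoke Sv) Su Sv
    where
    via-centre : ∀ {u v} → u ≡ m ⊎ Edge G m u → v ≡ m ⊎ Edge G m v → S u → S v → WalkIn G S u v
    via-centre (inj₁ refl) (inj₁ refl) Su _  = here Su
    via-centre (inj₁ refl) (inj₂ mv)   Su Sv = step Su mv (here Sv)
    via-centre (inj₂ mu)   (inj₁ refl) Su Sv = step Su (edge-sym mu) (here Sv)
    via-centre (inj₂ mu)   (inj₂ mv)   Su Sv = step Su (edge-sym mu) (step Sm mv (here Sv))

  connectedTriple⇒connectedTripleᵇ : ∀ {x y z} → ConnectedTriple G x y z → connectedTripleᵇ G x y z ≡ true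
  connectedTriple⇒connectedTripleᵇ {x} {y} {z} (x≢y , y≢z , x≢z , connected) =
    majority-intro from-x from-y from-z
    where
    from-x : Edge G x y ⊎ Edge G x z
    from-x with first-step connected (inj₁ refl) (inj₂ (inj₁ refl)) x≢y
    ... | _ , inj₁ refl        , xx = contradiction refl (edge⇒≢ xx)
    ... | _ , inj₂ (inj₁ refl) , xy = inj₁ xy
    ... | _ , inj₂ (inj₂ refl) , xz = inj₂ xz
    from-y : Edge G x y ⊎ Edge G y z
    from-y with first-step connected (inj₂ (inj₁ refl)) (inj₂ (inj₂ refl)) y≢z
    ... | _ , inj₁ refl        , yx = inj₁ (edge-sym yx)
    ... | _ , inj₂ (inj₁ refl) , yy = contradiction refl (edge⇒≢ yy)
    ... | _ , inj₂ (inj₂ refl) , yz = inj₂ yz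
    from-z : Edge G x z ⊎ Edge G y z
    from-z with first-step connected (inj₂ (inj₂ refl)) (inj₁ refl) (≢-sym x≢z)
    ... | _ , inj₁ refl        , zx = inj₁ (edge-sym zx)
    ... | _ , inj₂ (inj₁ refl) , zy = inj₂ (edge-sym zy)
    ... | _ , inj₂ (inj₂ refl) , zz = contradiction refl (edge⇒≢ zz)

  connectedTripleᵇ⇒connectedTriple : ∀ {x y z} → x ≢ y → y ≢ z → x ≢ z →
                             connectedTripleᵇ G x y z ≡ true → ConnectedTriple G x y z
  connectedTripleᵇ⇒connectedTriple {x} {y} {z} x≢y y≢z x≢z maj =
    x≢y , y≢z , x≢z , centred (majority-elim maj)
    where
    centred : (Edge G x y × Edge G x z) ⊎ (Edge G x y × Edge G y z) ⊎ (Edge G x z × Edge G y z) →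
              ConnectedOn G (λ v → v ≡ x ⊎ v ≡ y ⊎ v ≡ z)
    centred (inj₁ (xy , xz)) = star (inj₁ refl) λ
      { (inj₁ refl)        → inj₁ refl
      ; (inj₂ (inj₁ refl)) → inj₂ xy
      ; (inj₂ (inj₂ refl)) → inj₂ xz }
    centred (inj₂ (inj₁ (xy , yz))) = star (inj₂ (inj₁ refl)) λ
      { (inj₁ refl)        → inj₂ (edge-sym xy)
      ; (inj₂ (inj₁ refl)) → inj₁ refl
      ; (inj₂ (inj₂ refl)) → inj₂ yz }
    centred (inj₂ (inj₂ (xz , yz))) = star (inj₂ (inj₂ refl)) λ
      { (inj₁ refl)        → inj₂ (edge-sym xz)
      ; (inj₂ (inj₁ refl)) → inj₂ (edge-sym yz)
      ; (inj₂ (inj₂ refl)) → inj₁ refl }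

SameConnectedTriplesᵇ : ∀ {n} → Graph n → Graph n → Set
SameConnectedTriplesᵇ {n} G H =
  ∀ (x y z : Fin n) → x ≢ y → y ≢ z → x ≢ z → connectedTripleᵇ G x y z ≡ connectedTripleᵇ H x y z

sameConnectedTriplesᵇ-sym : ∀ {n} {G H : Graph n} → SameConnectedTriplesᵇ G H → SameConnectedTriplesᵇ H G
sameConnectedTriplesᵇ-sym agree x y z x≢y y≢z x≢z = sym (agree x y z x≢y y≢z x≢z)

sameConnectedTriples⇒ᵇ : ∀ {n} {G H : Graph n} → SameConnectedTriples G H → SameConnectedTriplesᵇ G H
sameConnectedTriples⇒ᵇ {G = G} {H} same x y z x≢y y≢z x≢z =
  ⇔→≡ (mk⇔ (transfer G H (Equivalence.to (same x y z))) (transfer H G (Equivalence.from (same x y z))))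
  where
  transfer : ∀ K L → (ConnectedTriple K x y z → ConnectedTriple L x y z) →
             connectedTripleᵇ K x y z ≡ true → connectedTripleᵇ L x y z ≡ true
  transfer K L K⇒L =
    connectedTriple⇒connectedTripleᵇ L ∘ K⇒L ∘ connectedTripleᵇ⇒connectedTriple K x≢y y≢z x≢z

module SameTriples {n} (G H : Graph n) (agree : SameConnectedTriplesᵇ G H) where

  private
    agree-with : ∀ {x y z p p′} → adj G x y ≡ p → adj H x y ≡ p′ → x ≢ y → z ≢ x → z ≢ y →
                 majority p (adj G x z) (adj G y z) ≡ majority p′ (adj H x z) (adj H y z)
    agree-with refl refl x≢y z≢x z≢y = agree _ _ _ x≢y (≢-sym z≢y) (≢-sym z≢x)

  private-edge-neighbours : ∀ {x y z} → Edge G x y → adj H x y ≡ false → z ≢ x → z ≢ y →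
                 Edge G x z ⊎ Edge G y z → Edge H x z × Edge H y z
  private-edge-neighbours {x} {y} {z} Gxy ¬Hxy z≢x z≢y Gz =
    ∧-conicalˡ _ _ Hxz∧Hyz , ∧-conicalʳ _ _ Hxz∧Hyz
    where
    Hxz∧Hyz : adj H x z ∧ adj H y z ≡ true
    Hxz∧Hyz = trans (sym (agree-with Gxy ¬Hxy (edge⇒≢ G Gxy) z≢x z≢y)) (∨-true Gz)

  shared-edge-exchange : ∀ {x y z} → Edge G x y → Edge H x y → z ≢ x → z ≢ y →
                adj G x z ≡ false → adj H y z ≡ false → adj G y z ≡ adj H x z
  shared-edge-exchange {x} {y} {z} Gxy Hxy z≢x z≢y ¬Gxz ¬Hyz = begin
    adj G y z              ≡⟨ cong (_∨ adj G y z) (sym ¬Gxz) ⟩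
    adj G x z ∨ adj G y z  ≡⟨ agree-with Gxy Hxy (edge⇒≢ G Gxy) z≢x z≢y ⟩
    adj H x z ∨ adj H y z  ≡⟨ cong (adj H x z ∨_) ¬Hyz ⟩
    adj H x z ∨ false      ≡⟨ ∨-identityʳ (adj H x z) ⟩
    adj H x z              ∎
    where open ≡-Reasoning

module Outerplanarity {n} (G : Graph n) (outer : Outerplanar G) where

  pos : Fin n → Fin n
  pos = proj₁ outer

  pos-injective : ∀ {u v} → pos u ≡ pos v → u ≡ v
  pos-injective = proj₁ (proj₂ outer)

  no-crossing : ∀ {a b c d} → Edge G a b → Edge G c d →
                pos a < pos c → pos c < pos b → pos b < pos d → ⊥
  no-crossing ab cd a<c c<b b<d = proj₂ (proj₂ outer) _ _ _ _ ab cd (a<c , c<b , b<d)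

  Inside : Fin n → Fin n → Pred (Fin n) 0ℓ
  Inside a b w = pos a < pos w × pos w < pos b

  Outside : Fin n → Fin n → Pred (Fin n) 0ℓ
  Outside a b w = pos w < pos a ⊎ pos b < pos w

  inside? : ∀ a b → Decidable (Inside a b)
  inside? a b w = (pos a <? pos w) ×-dec (pos w <? pos b)

  outside? : ∀ a b → Decidable (Outside a b)
  outside? a b w = (pos w <? pos a) ⊎-dec (pos b <? pos w)

  inside-or-outside : ∀ {a b w} → w ≢ a → w ≢ b → Inside a b w ⊎ Outside a b w
  inside-or-outside {a} {b} {w} w≢a w≢b with <-cmp (pos w) (pos a) | <-cmp (pos w) (pos b)
  ... | tri< w<a _ _ | _            = inj₂ (inj₁ w<a)
  ... | tri≈ _ w≡a _ | _            = contradiction (pos-injective w≡a) w≢a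
  ... | tri> _ _ a<w | tri< w<b _ _ = inj₁ (a<w , w<b)
  ... | tri> _ _ _   | tri≈ _ w≡b _ = contradiction (pos-injective w≡b) w≢b
  ... | tri> _ _ _   | tri> _ _ b<w = inj₂ (inj₂ b<w)

  inside⇒¬outside : ∀ {a b w} → Inside a b w → ¬ Outside a b w
  inside⇒¬outside (a<w , _) (inj₁ w<a) = <-asym a<w w<a
  inside⇒¬outside (_ , w<b) (inj₂ b<w) = <-asym w<b b<w

  outside⇒¬inside : ∀ {a b w} → Outside a b w → ¬ Inside a b w
  outside⇒¬inside out in′ = inside⇒¬outside in′ out

  chord-separates : ∀ {a b u w} → Edge G a b → Inside a b u → Outside a b w → ¬ Edge G u w
  chord-separates ab (a<u , u<b) (inj₁ w<a) uw = no-crossing (edge-sym G uw) ab w<a a<u u<b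
  chord-separates ab (a<u , u<b) (inj₂ b<w) uw = no-crossing ab uw a<u u<b b<w

  inside-closed : ∀ {a b u w} → Edge G a b → Inside a b u → ¬ Inside a b w → w ≢ a → w ≢ b →
                  ¬ Edge G u w
  inside-closed ab in-u ¬in-w w≢a w≢b with inside-or-outside w≢a w≢b
  ... | inj₁ in-w  = contradiction in-w ¬in-w
  ... | inj₂ out-w = chord-separates ab in-u out-w

  outside-closed : ∀ {a b u w} → Edge G a b → Outside a b u → ¬ Outside a b w → w ≢ a → w ≢ b →
                   ¬ Edge G u w
  outside-closed ab out-u ¬out-w w≢a w≢b with inside-or-outside w≢a w≢b
  ... | inj₁ in-w  = chord-separates ab in-w out-u ∘ edge-sym G
  ... | inj₂ out-w = contradiction out-w ¬out-w

  CommonNeighbour : Fin n → Fin n → Pred (Fin n) 0ℓ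
  CommonNeighbour a b w = Edge G a w × Edge G b w

  ¬common-neighbours-inside : ∀ {a b u v} → u ≢ v → CommonNeighbour a b u → CommonNeighbour a b v →
                              Inside a b u → Inside a b v → ⊥
  ¬common-neighbours-inside {u = u} {v} u≢v (au , bu) (av , bv) (a<u , u<b) (a<v , v<b)
    with <-cmp (pos u) (pos v)
  ... | tri< u<v _ _ = no-crossing av (edge-sym G bu) a<u u<v v<b
  ... | tri≈ _ u≡v _ = u≢v (pos-injective u≡v)
  ... | tri> _ _ v<u = no-crossing au (edge-sym G bv) a<v v<u u<b

  ¬common-neighbours-outside : ∀ {a b u v} → pos a < pos b → u ≢ v →
                               CommonNeighbour a b u → CommonNeighbour a b v →
                               Outside a b u → Outside a b v → ⊥
  ¬common-neighbours-outside {u = u} {v} a<b u≢v (au , bu) (av , bv) (inj₁ u<a) (inj₁ v<a)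
    with <-cmp (pos u) (pos v)
  ... | tri< u<v _ _ = no-crossing (edge-sym G au) (edge-sym G bv) u<v v<a a<b
  ... | tri≈ _ u≡v _ = u≢v (pos-injective u≡v)
  ... | tri> _ _ v<u = no-crossing (edge-sym G av) (edge-sym G bu) v<u u<a a<b
  ¬common-neighbours-outside a<b _ (_ , bu) (av , _) (inj₁ u<a) (inj₂ b<v) =
    no-crossing (edge-sym G bu) av u<a a<b b<v
  ¬common-neighbours-outside a<b _ (au , _) (_ , bv) (inj₂ b<u) (inj₁ v<a) =
    no-crossing (edge-sym G bv) au v<a a<b b<u
  ¬common-neighbours-outside {u = u} {v} a<b u≢v (au , bu) (av , bv) (inj₂ b<u) (inj₂ b<v)
    with <-cmp (pos u) (pos v)
  ... | tri< u<v _ _ = no-crossing au bv a<b b<u u<v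
  ... | tri≈ _ u≡v _ = u≢v (pos-injective u≡v)
  ... | tri> _ _ v<u = no-crossing av bu a<b b<v v<u

  common-neighbour-side : ∀ {a b w} → CommonNeighbour a b w → Inside a b w ⊎ Outside a b w
  common-neighbour-side (aw , bw) = inside-or-outside (≢-sym (edge⇒≢ G aw)) (≢-sym (edge⇒≢ G bw))

  private
    no-K₂,₃-ordered : ∀ {a b u v w} → pos a < pos b → u ≢ v → u ≢ w → v ≢ w →
                      CommonNeighbour a b u → CommonNeighbour a b v → CommonNeighbour a b w → ⊥
    no-K₂,₃-ordered a<b u≢v u≢w v≢w cu cv cw
      with common-neighbour-side cu | common-neighbour-side cv | common-neighbour-side cw
    ... | inj₁ in-u  | inj₁ in-v  | _          = ¬common-neighbours-inside u≢v cu cv in-u in-v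
    ... | inj₁ in-u  | inj₂ _     | inj₁ in-w  = ¬common-neighbours-inside u≢w cu cw in-u in-w
    ... | inj₂ _     | inj₁ in-v  | inj₁ in-w  = ¬common-neighbours-inside v≢w cv cw in-v in-w
    ... | inj₂ out-u | inj₂ out-v | _          = ¬common-neighbours-outside a<b u≢v cu cv out-u out-v
    ... | inj₂ out-u | inj₁ _     | inj₂ out-w = ¬common-neighbours-outside a<b u≢w cu cw out-u out-w
    ... | inj₁ _     | inj₂ out-v | inj₂ out-w = ¬common-neighbours-outside a<b v≢w cv cw out-v out-w

  no-K₂,₃ : ∀ {a b u v w} → a ≢ b → u ≢ v → u ≢ w → v ≢ w →
            CommonNeighbour a b u → CommonNeighbour a b v → CommonNeighbour a b w → ⊥
  no-K₂,₃ {a} {b} a≢b u≢v u≢w v≢w cu cv cw with <-cmp (pos a) (pos b)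
  ... | tri< a<b _ _ = no-K₂,₃-ordered a<b u≢v u≢w v≢w cu cv cw
  ... | tri≈ _ a≡b _ = a≢b (pos-injective a≡b)
  ... | tri> _ _ b<a = no-K₂,₃-ordered b<a u≢v u≢w v≢w (swap cu) (swap cv) (swap cw)

module EdgeInclusion {n} (6≤n : 6 ≤ n) (G H : Graph n)
  (2-connected : KConnected 2 G) (outerG : Outerplanar G) (outerH : Outerplanar H)
  (agree : SameConnectedTriplesᵇ G H) where

  module GH = SameTriples G H agree
  module HG = SameTriples H G (sameConnectedTriplesᵇ-sym {G = G} {H} agree)
  module OG = Outerplanarity G outerG
  module OH = Outerplanarity H outerH

  fresh-vertex : (xs : List (Fin n)) → length xs ≤ 5 → ∃ λ y → All (y ≢_) xs
  fresh-vertex xs |xs|≤5 = fresh xs (ℕ.≤-trans (s≤s |xs|≤5) 6≤n)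

  Rest : Fin n → Fin n → Fin n → Fin n → Pred (Fin n) 0ℓ
  Rest a b c d w = All (w ≢_) (a ∷ b ∷ c ∷ d ∷ [])

  rest? : ∀ a b c d → Decidable (Rest a b c d)
  rest? a b c d w = all? (λ v → ¬? (w ≟ v)) _

  two-rest-vertices : ∀ a b c d → ∃₂ λ f₁ f₂ → Rest a b c d f₁ × Rest a b c d f₂ × f₂ ≢ f₁
  two-rest-vertices a b c d
    with f₁ , r₁ ← fresh-vertex (a ∷ b ∷ c ∷ d ∷ []) (s≤s (s≤s (s≤s (s≤s z≤n))))
    with f₂ , f₂≢f₁ ∷ r₂ ← fresh-vertex (f₁ ∷ a ∷ b ∷ c ∷ d ∷ []) ℕ.≤-refl
    = f₁ , f₂ , r₁ , r₂ , f₂≢f₁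

  record Configuration (a b c d : Fin n) : Set where
    field
      a≢b : a ≢ b
      a≢c : a ≢ c
      a≢d : a ≢ d
      b≢c : b ≢ c
      b≢d : b ≢ d
      c≢d : c ≢ d
      Gab : Edge G a b
      c-attached : Edge G a c ⊎ Edge G b c
      d-attached : Edge G a d ⊎ Edge G b d
      Hac : Edge H a c
      Had : Edge H a d
      Hbc : Edge H b c
      Hbd : Edge H b d
      ¬Ga-rest : ∀ {w} → Rest a b c d w → adj G a w ≡ false
      ¬Gb-rest : ∀ {w} → Rest a b c d w → adj G b w ≡ false

  swapAB : ∀ {a b c d} → Configuration a b c d → Configuration b a c d
  swapAB C = record
    { a≢b = ≢-sym a≢b ; a≢c = b≢c ; a≢d = b≢d ; b≢c = a≢c ; b≢d = a≢d ; c≢d = c≢d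
    ; Gab = edge-sym G Gab ; c-attached = ⊎-swap c-attached ; d-attached = ⊎-swap d-attached
    ; Hac = Hbc ; Had = Hbd ; Hbc = Hac ; Hbd = Had
    ; ¬Ga-rest = λ { (w≢b ∷ w≢a ∷ r) → ¬Gb-rest (w≢a ∷ w≢b ∷ r) }
    ; ¬Gb-rest = λ { (w≢b ∷ w≢a ∷ r) → ¬Ga-rest (w≢a ∷ w≢b ∷ r) } }
    where open Configuration C

  swapCD-rest : ∀ {a b c d w} → Rest a b c d w → Rest a b d c w
  swapCD-rest (w≢a ∷ w≢b ∷ w≢c ∷ w≢d ∷ []) = w≢a ∷ w≢b ∷ w≢d ∷ w≢c ∷ []

  swapCD : ∀ {a b c d} → Configuration a b c d → Configuration a b d c
  swapCD C = record
    { a≢b = a≢b ; a≢c = a≢d ; a≢d = a≢c ; b≢c = b≢d ; b≢d = b≢c ; c≢d = ≢-sym c≢d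
    ; Gab = Gab ; c-attached = d-attached ; d-attached = c-attached
    ; Hac = Had ; Had = Hac ; Hbc = Hbd ; Hbd = Hbc
    ; ¬Ga-rest = ¬Ga-rest ∘ swapCD-rest ; ¬Gb-rest = ¬Gb-rest ∘ swapCD-rest }
    where open Configuration C

  module _ {a b c d} (C : Configuration a b c d) where
    open Configuration C

    classify : ∀ w → w ≡ a ⊎ w ≡ b ⊎ w ≡ c ⊎ w ≡ d ⊎ Rest a b c d w
    classify w with w ≟ a | w ≟ b | w ≟ c | w ≟ d
    ... | yes w≡a | _       | _       | _       = inj₁ w≡a
    ... | no _    | yes w≡b | _       | _       = inj₂ (inj₁ w≡b)
    ... | no _    | no _    | yes w≡c | _       = inj₂ (inj₂ (inj₁ w≡c))
    ... | no _    | no _    | no _    | yes w≡d = inj₂ (inj₂ (inj₂ (inj₁ w≡d)))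
    ... | no w≢a  | no w≢b  | no w≢c  | no w≢d  =
      inj₂ (inj₂ (inj₂ (inj₂ (w≢a ∷ w≢b ∷ w≢c ∷ w≢d ∷ []))))

    closed-rest-part-absurd : ∀ {P : Pred (Fin n) 0ℓ} → Decidable P → (∀ {w} → P w → Rest a b c d w) →
                              (∀ {u w} → P u → Rest a b c d w → ¬ P w → ¬ Edge G u w) →
                              (∀ {u} → P u → ¬ Edge G u d) → ∀ {e} → P e → ⊥
    -- P can only be left through c, so removing c would separate P from a.
    closed-rest-part-absurd {P} P? P⊆rest inner-closed ¬to-d {e} Pe =
      escape (exit-avoiding G 2-connected P? Pe ¬Pa e≢c a≢c)
      where
      ¬Pa : ¬ P a
      ¬Pa Pa with a≢a ∷ _ ← P⊆rest Pa = a≢a refl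
      e≢c : e ≢ c
      e≢c with _ ∷ _ ∷ e≢c ∷ _ ← P⊆rest Pe = e≢c
      escape : (∃₂ λ u w → P u × ¬ P w × w ≢ c × Edge G u w) → ⊥
      escape (u , w , Pu , ¬Pw , w≢c , uw) with classify w
      ... | inj₁ refl                      = not-¬ (edge-sym G uw) (¬Ga-rest (P⊆rest Pu))
      ... | inj₂ (inj₁ refl)               = not-¬ (edge-sym G uw) (¬Gb-rest (P⊆rest Pu))
      ... | inj₂ (inj₂ (inj₁ refl))        = w≢c refl
      ... | inj₂ (inj₂ (inj₂ (inj₁ refl))) = ¬to-d Pu uw
      ... | inj₂ (inj₂ (inj₂ (inj₂ rest))) = inner-closed Pu rest ¬Pw uw

    closed-side-absurd : ∀ {S : Pred (Fin n) 0ℓ} → Decidable S →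
                         (∀ {u w} → S u → ¬ S w → w ≢ a → w ≢ b → ¬ Edge G u w) → ¬ S d →
                         ∀ {e} → Rest a b c d e → S e → ⊥
    closed-side-absurd {S} S? closed ¬Sd re Se =
      closed-rest-part-absurd (λ w → rest? a b c d w ×-dec S? w) proj₁ inner-closed ¬to-d (re , Se)
      where
      inner-closed : ∀ {u w} → Rest a b c d u × S u → Rest a b c d w → ¬ (Rest a b c d w × S w) →
                     ¬ Edge G u w
      inner-closed (_ , Su) rw@(w≢a ∷ w≢b ∷ _) ¬Pw = closed Su (λ Sw → ¬Pw (rw , Sw)) w≢a w≢b
      ¬to-d : ∀ {u} → Rest a b c d u × S u → ¬ Edge G u d
      ¬to-d (_ , Su) = closed Su ¬Sd (≢-sym a≢d) (≢-sym b≢d)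

    rest-inside-absurd : ¬ OG.Inside a b d → ∀ {e} → Rest a b c d e → OG.Inside a b e → ⊥
    rest-inside-absurd = closed-side-absurd (OG.inside? a b) (OG.inside-closed Gab)

    rest-outside-absurd : ¬ OG.Outside a b d → ∀ {e} → Rest a b c d e → OG.Outside a b e → ⊥
    rest-outside-absurd = closed-side-absurd (OG.outside? a b) (OG.outside-closed Gab)

    module _ (Gad : Edge G a d) (¬Gbd : adj G b d ≡ false) where

      ¬Hd-rest : ∀ {w} → Rest a b c d w → adj H d w ≡ false
      ¬Hd-rest rw@(_ ∷ w≢b ∷ _ ∷ w≢d ∷ []) = ¬-not λ Hdw →
        not-¬ (proj₁ (HG.private-edge-neighbours Hbd ¬Gbd w≢b w≢d (inj₂ Hdw))) (¬Gb-rest rw)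

      d-rest-neighbour-unique : ∀ {e f} → Rest a b c d e → Rest a b c d f → f ≢ e → Edge G d e →
                                adj G d f ≡ false × adj G e f ≡ false
      d-rest-neighbour-unique {e} {f} re@(e≢a ∷ _ ∷ _ ∷ e≢d ∷ []) rf@(f≢a ∷ _ ∷ _ ∷ f≢d ∷ []) f≢e Gde
        = ¬Gdf , ¬Gef
        where
        -- compare the triples {a, d, e}, {a, e, f}, {a, d, f} and {d, e, f} in G and H
        ¬Gae : adj G a e ≡ false
        ¬Gae = ¬Ga-rest re
        Hae : Edge H a e
        Hae = trans (sym (GH.shared-edge-exchange Gad Had e≢a e≢d ¬Gae (¬Hd-rest re))) Gde
        ¬Haf : adj H a f ≡ false
        ¬Haf = ¬-not λ Haf →
          not-¬ (proj₁ (HG.private-edge-neighbours Hae ¬Gae f≢a f≢e (inj₁ Haf))) (¬Ga-rest rf)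
        ¬Hef : adj H e f ≡ false
        ¬Hef = ¬-not λ Hef →
          not-¬ (proj₁ (HG.private-edge-neighbours Hae ¬Gae f≢a f≢e (inj₂ Hef))) (¬Ga-rest rf)
        ¬Gdf : adj G d f ≡ false
        ¬Gdf = trans (GH.shared-edge-exchange Gad Had f≢a f≢d (¬Ga-rest rf) (¬Hd-rest rf)) ¬Haf
        ¬Gef : adj G e f ≡ false
        ¬Gef = ¬-not λ Gef →
          not-¬ (proj₂ (GH.private-edge-neighbours Gde (¬Hd-rest re) f≢d f≢e (inj₂ Gef))) ¬Hef

      FarFromD : Pred (Fin n) 0ℓ
      FarFromD w = Rest a b c d w × adj G d w ≡ false

      far-from-d-absurd : ∀ {e} → FarFromD e → ⊥
      far-from-d-absurd =
        closed-rest-part-absurd far? proj₁ inner-closed ¬to-d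
        where
        far? : Decidable FarFromD
        far? w = rest? a b c d w ×-dec (adj G d w Bool.≟ false)
        inner-closed : ∀ {u w} → FarFromD u → Rest a b c d w → ¬ FarFromD w → ¬ Edge G u w
        inner-closed {w = w} (ru , _) rw ¬Fw uw with edge? G d w
        ... | no ¬Gdw = ¬Fw (rw , ¬-not ¬Gdw)
        ... | yes Gdw =
          not-¬ (edge-sym G uw) (proj₂ (d-rest-neighbour-unique rw ru (edge⇒≢ G uw) Gdw))
        ¬to-d : ∀ {u} → FarFromD u → ¬ Edge G u d
        ¬to-d (_ , ¬Gdu) ud = not-¬ (edge-sym G ud) ¬Gdu

      some-far-from-d : ∃ FarFromD
      some-far-from-d with f₁ , f₂ , r₁ , r₂ , f₂≢f₁ ← two-rest-vertices a b c d | edge? G d f₁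
      ... | no ¬Gdf₁ = f₁ , r₁ , ¬-not ¬Gdf₁
      ... | yes Gdf₁ = f₂ , r₂ , proj₁ (d-rest-neighbour-unique r₁ r₂ f₂≢f₁ Gdf₁)

      one-sided-absurd : ⊥
      one-sided-absurd = far-from-d-absurd (proj₂ some-far-from-d)

  opposite-sides-absurd : ∀ {a b c d} → Configuration a b c d → OG.pos a < OG.pos b →
                          OG.CommonNeighbour a b c → OG.CommonNeighbour a b d → ⊥
  opposite-sides-absurd {a} {b} {c} {d} C a<b cc cd
    with e , re@(e≢a ∷ e≢b ∷ _) ← fresh-vertex (a ∷ b ∷ c ∷ d ∷ []) (s≤s (s≤s (s≤s (s≤s z≤n))))
    with OG.common-neighbour-side cc | OG.common-neighbour-side cd | OG.inside-or-outside e≢a e≢b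
  ... | inj₁ in-c  | inj₁ in-d  | _          =
    OG.¬common-neighbours-inside (Configuration.c≢d C) cc cd in-c in-d
  ... | inj₂ out-c | inj₂ out-d | _          =
    OG.¬common-neighbours-outside a<b (Configuration.c≢d C) cc cd out-c out-d
  ... | _          | inj₂ out-d | inj₁ in-e  = rest-inside-absurd C (OG.outside⇒¬inside out-d) re in-e
  ... | _          | inj₁ in-d  | inj₂ out-e = rest-outside-absurd C (OG.inside⇒¬outside in-d) re out-e
  ... | inj₁ in-c  | inj₂ _     | inj₂ out-e =
    rest-outside-absurd (swapCD C) (OG.inside⇒¬outside in-c) (swapCD-rest re) out-e
  ... | inj₂ out-c | inj₁ _     | inj₁ in-e  =
    rest-inside-absurd (swapCD C) (OG.outside⇒¬inside out-c) (swapCD-rest re) in-e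

  two-sided-absurd : ∀ {a b c d} → Configuration a b c d →
                     Edge G a c → Edge G b c → Edge G a d → Edge G b d → ⊥
  two-sided-absurd {a} {b} C Gac Gbc Gad Gbd with <-cmp (OG.pos a) (OG.pos b)
  ... | tri< a<b _ _ = opposite-sides-absurd C a<b (Gac , Gbc) (Gad , Gbd)
  ... | tri≈ _ a≡b _ = Configuration.a≢b C (OG.pos-injective a≡b)
  ... | tri> _ _ b<a = opposite-sides-absurd (swapAB C) b<a (Gbc , Gac) (Gbd , Gad)

  configuration-absurd : ∀ {a b c d} → ¬ Configuration a b c d
  configuration-absurd {a} {b} {c} {d} C
    with edge? G a c | edge? G b c | edge? G a d | edge? G b d
  ... | _       | _       | yes Gad | no ¬Gbd = one-sided-absurd C Gad (¬-not ¬Gbd)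
  ... | _       | _       | no ¬Gad | yes Gbd = one-sided-absurd (swapAB C) Gbd (¬-not ¬Gad)
  ... | yes Gac | no ¬Gbc | _       | _       = one-sided-absurd (swapCD C) Gac (¬-not ¬Gbc)
  ... | no ¬Gac | yes Gbc | _       | _       = one-sided-absurd (swapAB (swapCD C)) Gbc (¬-not ¬Gac)
  ... | yes Gac | yes Gbc | yes Gad | yes Gbd = two-sided-absurd C Gac Gbc Gad Gbd
  ... | no ¬Gac | no ¬Gbc | _       | _       = [ ¬Gac , ¬Gbc ] (Configuration.c-attached C)
  ... | _       | _       | no ¬Gad | no ¬Gbd = [ ¬Gad , ¬Gbd ] (Configuration.d-attached C)

  module _ {a b} (Gab : Edge G a b) (¬Hab : adj H a b ≡ false) where

    Attached : Pred (Fin n) 0ℓ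
    Attached w = w ≢ a × w ≢ b × (Edge G a w ⊎ Edge G b w)

    attached⇒common-H-neighbour : ∀ {w} → Attached w → OH.CommonNeighbour a b w
    attached⇒common-H-neighbour (w≢a , w≢b , Gw) = GH.private-edge-neighbours Gab ¬Hab w≢a w≢b Gw

    attached-avoiding : ∀ {y z} → y ≢ a → y ≢ b → y ≢ z → a ≢ z → ∃ λ w → Attached w × w ≢ z
    attached-avoiding {z = z} y≢a y≢b y≢z a≢z =
      exit-attached (exit-avoiding G 2-connected ab? (inj₁ refl) [ y≢a , y≢b ] a≢z y≢z)
      where
      ab? : Decidable (λ v → v ≡ a ⊎ v ≡ b)
      ab? v = (v ≟ a) ⊎-dec (v ≟ b)
      exit-attached : (∃₂ λ u w → (u ≡ a ⊎ u ≡ b) × ¬ (w ≡ a ⊎ w ≡ b) × w ≢ z × Edge G u w) →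
                      ∃ λ w → Attached w × w ≢ z
      exit-attached (_ , w , inj₁ refl , w∉ab , w≢z , aw) =
        w , (w∉ab ∘ inj₁ , w∉ab ∘ inj₂ , inj₁ aw) , w≢z
      exit-attached (_ , w , inj₂ refl , w∉ab , w≢z , bw) =
        w , (w∉ab ∘ inj₁ , w∉ab ∘ inj₂ , inj₂ bw) , w≢z

    two-attached : ∃₂ λ c d → Attached c × Attached d × c ≢ d
    two-attached
      with y , y≢a ∷ y≢b ∷ [] ← fresh-vertex (a ∷ b ∷ []) (s≤s (s≤s z≤n))
      -- for z = b the extra conclusion w ≢ b is already part of Attached w
      with c , Ac , _ ← attached-avoiding y≢a y≢b y≢b (edge⇒≢ G Gab)
      with y′ , y′≢a ∷ y′≢b ∷ y′≢c ∷ [] ← fresh-vertex (a ∷ b ∷ c ∷ []) (s≤s (s≤s (s≤s z≤n)))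
      with d , Ad , d≢c ← attached-avoiding y′≢a y′≢b y′≢c (≢-sym (proj₁ Ac))
      = c , d , Ac , Ad , ≢-sym d≢c

    unattached : ∀ {c d w} → Attached c → Attached d → c ≢ d → Rest a b c d w →
                 ¬ (Edge G a w ⊎ Edge G b w)
    unattached Ac Ad c≢d (w≢a ∷ w≢b ∷ w≢c ∷ w≢d ∷ []) Gw =
      OH.no-K₂,₃ (edge⇒≢ G Gab) c≢d (≢-sym w≢c) (≢-sym w≢d)
        (attached⇒common-H-neighbour Ac) (attached⇒common-H-neighbour Ad)
        (attached⇒common-H-neighbour (w≢a , w≢b , Gw))

    configuration : ∀ {c d} → Attached c → Attached d → c ≢ d → Configuration a b c d
    configuration Ac@(c≢a , c≢b , Gc) Ad@(d≢a , d≢b , Gd) c≢d = record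
      { a≢b = edge⇒≢ G Gab ; a≢c = ≢-sym c≢a ; a≢d = ≢-sym d≢a ; b≢c = ≢-sym c≢b ; b≢d = ≢-sym d≢b
      ; c≢d = c≢d
      ; Gab = Gab
      ; c-attached = Gc
      ; d-attached = Gd
      ; Hac = proj₁ (attached⇒common-H-neighbour Ac)
      ; Had = proj₁ (attached⇒common-H-neighbour Ad)
      ; Hbc = proj₂ (attached⇒common-H-neighbour Ac)
      ; Hbd = proj₂ (attached⇒common-H-neighbour Ad)
      ; ¬Ga-rest = λ rw → ¬-not (unattached Ac Ad c≢d rw ∘ inj₁)
      ; ¬Gb-rest = λ rw → ¬-not (unattached Ac Ad c≢d rw ∘ inj₂) }

    private-edge-absurd : ⊥
    private-edge-absurd =
      let c , d , Ac , Ad , c≢d = two-attached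
      in  configuration-absurd (configuration Ac Ad c≢d)

  edge-preserved : ∀ {u v} → Edge G u v → Edge H u v
  edge-preserved {u} {v} Guv =
    decidable-stable (edge? H u v) λ ¬Huv → private-edge-absurd Guv (¬-not ¬Huv)

theorem3 : (n : ℕ) → 6 ≤ n → (G H : Graph n) →
    KConnected 2 G → Outerplanar G →
    KConnected 2 H → Outerplanar H →
    SameConnectedTriples G H → SameGraph G H
theorem3 _ 6≤n G H 2-connected-G outer-G 2-connected-H outer-H same u v =
  ⇔→≡ (mk⇔ G⊆H.edge-preserved H⊆G.edge-preserved)
  where
  agree : SameConnectedTriplesᵇ G H
  agree = sameConnectedTriples⇒ᵇ same
  module G⊆H = EdgeInclusion 6≤n G H 2-connected-G outer-G outer-H agree
  module H⊆G = EdgeInclusion 6≤n H G 2-connected-H outer-H outer-G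
                             (sameConnectedTriplesᵇ-sym {G = G} {H} agree)
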